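{- For every integer $k \ge 1$, there exists a periodic identifying code $C^*$ in the strip $S_k$, with pattern length $l \le 2^{4k}$, such that the density $d(C^*,S_k)$ exists and equals $d^*(S_k)$.
   Context: For $k\ge 1$, the strip $S_k$ is the subgraph of the square grid (vertex set $\mathbb{Z}^2$, edges between points at Euclidean distance $1$) induced by $\mathbb{Z}\times\{0,\ldots,k-1\}$. For a vertex $v$ of a graph $G$, $N[v]$ denotes its closed neighborhood ($v$ together with its neighbors). A set $C\subseteq V(G)$ is an identifying code of $G$ if $N[v]\cap C\neq\emptyset$ for every vertex $v$, and $N[u]\cap C\neq N[v]\cap C$ for every pair of distinct vertices $u,v$. Fix a vertex $v_0$ and let $B_r(v_0)$ be the set of vertices at graph distance at most $r$ from $v_0$. The upper density of $C$ is $\overline{d}(C,G)=\limsup_{r\to\infty}|C\cap B_r(v_0)|/|B_r(v_0)|$; the lower density is the corresponding $\liminf$, and when they coincide their common value is the density $d(C,G)$. The infimum density is $d^*(G)=\inf_C \overline{d}(C,G)$ over all identifying codes $C$ of $G$. A periodic identifying code in $S_k$ with pattern length $l\ge1$ is an identifying code $C$ invariant under the translation $(x,y)\mapsto(x+l,y)$; it is obtained by repeating its restriction to $l$ consecutive columns (a bar pattern), and its density is $|C\cap(\{0,\ldots,l-1\}\times\{0,\ldots,k-1\})|/(lk)$. -}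

module Defs where

open import Data.Nat as ℕ using (ℕ; zero; suc; _≤_; _≤ᵇ_)
open import Data.Integer as ℤ using (ℤ; +_; ∣_∣)
open import Data.Fin using (Fin; toℕ)
open import Data.Bool using (Bool; true; false; _∧_; if_then_else_)
open import Data.List using (List; map; upTo; allFin)
open import Data.Nat.ListAction using (sum)
open import Data.Product using (_×_; _,_; Σ; ∃)
open import Data.Sum using (_⊎_)
open import Data.Rational as ℚ using (ℚ; 0ℚ; _/_; _<_; _-_; _+_)
open import Relation.Binary.PropositionalEquality using (_≡_; _≢_)
open import Relation.Nullary using (¬_)

Vertex : ℕ → Set
Vertex k = ℤ × Fin k

Code : ℕ → Set
Code k = ℤ → Fin k → Bool

Adj : ∀ {k} → Vertex k → Vertex k → Set
Adj (x , y) (x' , y') =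
    (x' ≡ x ℤ.+ ℤ.1ℤ × y' ≡ y)
  ⊎ (x ≡ x' ℤ.+ ℤ.1ℤ × y ≡ y')
  ⊎ (x ≡ x' × toℕ y' ≡ suc (toℕ y))
  ⊎ (x ≡ x' × toℕ y ≡ suc (toℕ y'))

InN : ∀ {k} → Vertex k → Vertex k → Set
InN v w = v ≡ w ⊎ Adj v w

InCode : ∀ {k} → Code k → Vertex k → Set
InCode C (x , y) = C x y ≡ true

IsIdentifyingCode : (k : ℕ) → Code k → Set
IsIdentifyingCode k C =
    (∀ (v : Vertex k) → ∃ λ (w : Vertex k) → InN v w × InCode C w)
  × (∀ (u v : Vertex k) → u ≢ v →
       ¬ (∀ (w : Vertex k) →
            ((InN u w × InCode C w) → (InN v w × InCode C w))
          × ((InN v w × InCode C w) → (InN u w × InCode C w))))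

IsPeriodic : (k : ℕ) → ℕ → Code k → Set
IsPeriodic k l C = ∀ (x : ℤ) (y : Fin k) → C (x ℤ.+ + l) y ≡ C x y

-- Graph distance from v₀ = (0,0) in S_k is |x| + y (strip is convex in y).
inBall : ∀ {k} → ℕ → ℤ → Fin k → Bool
inBall r x y = (∣ x ∣ ℕ.+ toℕ y) ≤ᵇ r

range : ℕ → List ℤ
range r = map (λ i → + i ℤ.- + r) (upTo (suc (r ℕ.+ r)))

countBall : (k : ℕ) → Code k → ℕ → ℕ
countBall k S r =
  sum (map (λ x → sum (map (λ y → if inBall r x y ∧ S x y then 1 else 0) (allFin k))) (range r))

codeInBall : (k : ℕ) → Code k → ℕ → ℕ
codeInBall k C r = countBall k C r

ballSize : (k : ℕ) → ℕ → ℕ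
ballSize k r = countBall k (λ _ _ → true) r

frac : ℕ → ℕ → ℚ
frac a zero = 0ℚ
frac a (suc b) = (+ a) / suc b

-- the ratio |C ∩ B_r| / |B_r|   (|B_r| ≥ 1 for k ≥ 1)
ratio : (k : ℕ) → Code k → ℕ → ℚ
ratio k C r = frac (codeInBall k C r) (ballSize k r)

HasDensity : (k : ℕ) → Code k → ℚ → Set
HasDensity k C d =
  ∀ (ε : ℚ) → 0ℚ < ε → ∃ λ (R : ℕ) → ∀ (r : ℕ) → R ≤ r →
    (d - ε < ratio k C r) × (ratio k C r < d + ε)

UpperDensityAtLeast : (k : ℕ) → Code k → ℚ → Set
UpperDensityAtLeast k C d =
  ∀ (ε : ℚ) → 0ℚ < ε → ∀ (R : ℕ) → ∃ λ (r : ℕ) → R ≤ r × (d - ε < ratio k C r)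

-- d equals d*(S_k) = inf over identifying codes C of the upper density,
-- given that d is attained (as upper density) by some identifying code:
-- it suffices that d is a lower bound for all upper densities.
IsLowerBoundOfUpperDensities : (k : ℕ) → ℚ → Set
IsLowerBoundOfUpperDensities k d =
  ∀ (C : Code k) → IsIdentifyingCode k C → UpperDensityAtLeast k C d

-- Being an identifying code of S_k is a local property: it holds iff every window of five
-- consecutive columns satisfies a decidable condition.  Read an identifying code as a sequence of
-- columns.  Among 2^(4k) + 1 consecutive positions two blocks of four consecutive columns coincide;
-- cutting out the segment between them leaves a valid sequence, and closing the segment up gives a
-- valid cyclic word of length at most 2^(4k).  Repeating this, every valid sequence of n columns
-- has weight at least (S/P)(n - 4 - 2^(4k)), where S/P is the least weight per column among the
-- finitely many valid cyclic words of length at most 2^(4k).  The periodic code obtained by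
-- repeating a minimising word has weight at most (S/P)(n + 2P) on n consecutive columns, so its
-- density exists, equals S/(Pk), and bounds every upper density from below.

module Submission where

open import Defs
open import Data.Nat as ℕ using (ℕ; zero; suc; _+_; _*_; _∸_; _^_; _≤_; _<_; z≤n; s≤s; _<?_; _≤?_; NonZero)
import Data.Nat.Properties as ℕₚ
open import Data.Nat.DivMod using (_%_; _mod_; m%n<n; m<n⇒m%n≡m; [m+n]%n≡m%n; %-distribˡ-+; n%n≡0; m%n%n≡m%n)
open import Data.Nat.Induction using (<-rec)
open import Data.Nat.ListAction using (sum)
open import Data.Nat.Coprimality using (Coprime)
open import Data.Nat.Tactic.RingSolver using (solve-∀)
open import Data.Integer as ℤ using (ℤ; +_; -[1+_]; ∣_∣; _⊖_; 1ℤ)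
import Data.Integer.Properties as ℤₚ
import Data.Integer.Tactic.RingSolver as ℤ-Solver
open import Algebra.Properties.AbelianGroup ℤₚ.+-0-abelianGroup using (∙-cancelˡ; ∙-cancelʳ)
open import Data.Rational as ℚ using (ℚ; mkℚ; 0ℚ; toℚᵘ)
import Data.Rational.Properties as ℚₚ
open import Data.Rational.Unnormalised as ℚᵘ using (mkℚᵘ)
import Data.Rational.Unnormalised.Properties as ℚᵘₚ
open import Data.Fin as Fin using (Fin; toℕ; fromℕ<; remQuot; combine; funToFin; finToFun)
import Data.Fin.Properties as Finₚ
open import Data.Vec as Vec using (Vec; []; _∷_; lookup; tabulate)
import Data.Vec.Properties as Vecₚ
open import Data.List as List using (List; []; _∷_; [_]; map; concatMap; upTo; applyUpTo; allFin; filter)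
import Data.List.Properties as Listₚ
open import Data.List.Membership.Propositional using (_∈_)
open import Data.List.Membership.Propositional.Properties using (∈-map⁺; ∈-concat⁺′; ∈-upTo⁺; ∈-filter⁺)
open import Data.List.Relation.Unary.Any using (here; there)
import Data.List.Relation.Unary.All as All
open import Data.List.Relation.Unary.All.Properties using (all-filter)
open import Relation.Binary.Bundles using (DecTotalOrder)
open import Data.List.Extrema (DecTotalOrder.totalOrder ℚₚ.≤-decTotalOrder) using (argmin; argmin-all; f[argmin]≤f[xs])
open import Data.Bool using (Bool; true; false; _∧_; if_then_else_)
import Data.Bool.Properties as Boolₚ
open import Data.Product using (_×_; _,_; Σ; ∃; ∃₂; proj₁; proj₂; swap)
open import Data.Product.Properties using (≡-dec)
open import Data.Sum using (_⊎_; inj₁; inj₂)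
open import Data.Empty using (⊥-elim)
open import Function using (_∘_; Equivalence)
open import Relation.Binary.PropositionalEquality hiding ([_])
open import Relation.Nullary using (Dec; yes; no; ¬_)
open import Relation.Nullary.Decidable using (_×-dec_; _⊎-dec_; _→-dec_; ¬?)

+-suc-+1 : ∀ X a → X ℤ.+ + suc a ≡ X ℤ.+ + a ℤ.+ 1ℤ
+-suc-+1 X a = trans (cong (λ t → X ℤ.+ + t) (ℕₚ.+-comm 1 a)) (sym (ℤₚ.+-assoc X (+ a) 1ℤ))

[m+n]∸o≤[m∸o]+n : ∀ m n o → (m + n) ∸ o ≤ (m ∸ o) + n
[m+n]∸o≤[m∸o]+n m n zero = ℕₚ.≤-refl
[m+n]∸o≤[m∸o]+n zero n (suc o) = ℕₚ.m∸n≤m n (suc o)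
[m+n]∸o≤[m∸o]+n (suc m) n (suc o) = [m+n]∸o≤[m∸o]+n m n o

%-cong-+ : ∀ p .{{_ : NonZero p}} a b c → a % p ≡ b % p → (a + c) % p ≡ (b + c) % p
%-cong-+ p a b c eq = trans (%-distribˡ-+ a c p) (trans (cong (λ z → (z + c % p) % p) eq) (sym (%-distribˡ-+ b c p)))

∣i⊖m∣≤m : ∀ i m → i ≤ m + m → ∣ i ⊖ m ∣ ≤ m
∣i⊖m∣≤m i m i≤2m with i ≤? m
... | yes i≤m = subst (_≤ m) (sym (ℤₚ.∣⊖∣-≤ i≤m)) (ℕₚ.m∸n≤m m i)
... | no i≰m = subst (_≤ m) (sym (trans (ℤₚ.∣m⊖n∣≡∣n⊖m∣ i m) (ℤₚ.∣⊖∣-≤ m≤i)))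
                 (subst (i ∸ m ≤_) (ℕₚ.m+n∸m≡n m m) (ℕₚ.∸-monoˡ-≤ m i≤2m))
  where
  m≤i : m ≤ i
  m≤i = ℕₚ.<⇒≤ (ℕₚ.≰⇒> i≰m)

toFin : ∀ {n} b → b < n → Σ (Fin n) λ i → toℕ i ≡ b
toFin b b<n = fromℕ< b<n , Finₚ.toℕ-fromℕ< b<n

∣Δ∣≤⇒offset : ∀ i j {n} → ∣ j ℤ.- i ∣ ≤ n → ∃ λ m → m ≤ n × (j ≡ i ℤ.+ + m ⊎ i ≡ j ℤ.+ + m)
∣Δ∣≤⇒offset i j h with j ℤ.- i in eq
... | + m = m , h , inj₁ (trans (split i j) (cong (λ t → i ℤ.+ t) eq))
  where
  split : ∀ i j → j ≡ i ℤ.+ (j ℤ.- i)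
  split = ℤ-Solver.solve-∀
... | -[1+ m ] = suc m , h , inj₂ (trans (split i j) (cong (λ t → j ℤ.- t) eq))
  where
  split : ∀ i j → i ≡ j ℤ.- (j ℤ.- i)
  split = ℤ-Solver.solve-∀

periodic-extension : ∀ {A : Set} (f : ℕ → A) p .{{_ : NonZero p}} c →
  (∀ r → r < c → f (p + r) ≡ f r) → ∀ r → r < p + c → f r ≡ f (r % p)
periodic-extension f p c repeat = <-rec (λ r → r < p + c → f r ≡ f (r % p)) step
  where
  step : ∀ r → (∀ {s} → s < r → s < p + c → f s ≡ f (s % p)) → r < p + c → f r ≡ f (r % p)
  step r ih r<p+c with r <? p
  ... | yes r<p = cong f (sym (m<n⇒m%n≡m r<p))
  ... | no r≮p = begin
      f r         ≡⟨ cong f (sym p+s≡r) ⟩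
      f (p + s)   ≡⟨ repeat s s<c ⟩
      f s         ≡⟨ ih s<r (ℕₚ.<-≤-trans s<c (ℕₚ.m≤n+m c p)) ⟩
      f (s % p)   ≡⟨ cong f (sym (trans (cong (_% p) (trans (sym p+s≡r) (ℕₚ.+-comm p s))) ([m+n]%n≡m%n s p))) ⟩
      f (r % p)   ∎
    where
    open ≡-Reasoning
    s = r ∸ p
    p+s≡r : p + s ≡ r
    p+s≡r = ℕₚ.m+[n∸m]≡n (ℕₚ.≮⇒≥ r≮p)
    s<c : s < c
    s<c = ℕₚ.+-cancelˡ-< p s c (subst (_< p + c) (sym p+s≡r) r<p+c)
    s<r : s < r
    s<r = subst (s <_) p+s≡r (ℕₚ.m<n+m s (ℕ.>-nonZero⁻¹ p))

sumUpTo : (ℕ → ℕ) → ℕ → ℕ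
sumUpTo f zero = 0
sumUpTo f (suc n) = f 0 + sumUpTo (f ∘ suc) n

sumUpTo-cong : ∀ n {f g} → (∀ t → t < n → f t ≡ g t) → sumUpTo f n ≡ sumUpTo g n
sumUpTo-cong zero f≗g = refl
sumUpTo-cong (suc n) f≗g = cong₂ _+_ (f≗g 0 (s≤s z≤n)) (sumUpTo-cong n λ t t<n → f≗g (suc t) (s≤s t<n))

sumUpTo-mono-≤ : ∀ n {f g} → (∀ t → t < n → f t ≤ g t) → sumUpTo f n ≤ sumUpTo g n
sumUpTo-mono-≤ zero f≤g = z≤n
sumUpTo-mono-≤ (suc n) f≤g = ℕₚ.+-mono-≤ (f≤g 0 (s≤s z≤n)) (sumUpTo-mono-≤ n λ t t<n → f≤g (suc t) (s≤s t<n))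

sumUpTo-+ : ∀ f a b → sumUpTo f (a + b) ≡ sumUpTo f a + sumUpTo (λ t → f (a + t)) b
sumUpTo-+ f zero b = refl
sumUpTo-+ f (suc a) b = trans (cong (λ s → f 0 + s) (sumUpTo-+ (f ∘ suc) a b)) (sym (ℕₚ.+-assoc (f 0) _ _))

sumUpTo-≤-+ : ∀ f a b → sumUpTo f a ≤ sumUpTo f (a + b)
sumUpTo-≤-+ f a b = subst (sumUpTo f a ≤_) (sym (sumUpTo-+ f a b)) (ℕₚ.m≤m+n _ _)

sumUpTo-const : ∀ c n → sumUpTo (λ _ → c) n ≡ n * c
sumUpTo-const c zero = refl
sumUpTo-const c (suc n) = cong (λ s → c + s) (sumUpTo-const c n)

bit : Bool → ℕ
bit b = if b then 1 else 0

weight : ∀ {n} → Vec Bool n → ℕ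
weight [] = 0
weight (b ∷ v) = bit b + weight v

sum-applyUpTo : ∀ (f : ℕ → ℕ) n → sum (applyUpTo f n) ≡ sumUpTo f n
sum-applyUpTo f zero = refl
sum-applyUpTo f (suc n) = cong (λ s → f 0 + s) (sum-applyUpTo (f ∘ suc) n)

sum-tabulate-bit : ∀ n (f : Fin n → Bool) → sum (List.tabulate (bit ∘ f)) ≡ weight (Vec.tabulate f)
sum-tabulate-bit zero f = refl
sum-tabulate-bit (suc n) f = cong (λ s → bit (f Fin.zero) + s) (sum-tabulate-bit n (f ∘ Fin.suc))

weight-allTrue : ∀ n → weight (Vec.tabulate {n = n} λ _ → true) ≡ n
weight-allTrue zero = refl
weight-allTrue (suc n) = cong suc (weight-allTrue n)

bit-∧ : ∀ a b → bit (a ∧ b) ≤ bit b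
bit-∧ true b = ℕₚ.≤-refl
bit-∧ false b = z≤n

allVecs : ∀ {A : Set} → List A → ∀ n → List (Vec A n)
allVecs xs zero = [ [] ]
allVecs xs (suc n) = concatMap (λ x → map (x ∷_) (allVecs xs n)) xs

∈-allVecs : ∀ {A : Set} {xs : List A} → (∀ a → a ∈ xs) → ∀ {n} (v : Vec A n) → v ∈ allVecs xs n
∈-allVecs every [] = here refl
∈-allVecs {xs = xs} every (a ∷ v) =
  ∈-concat⁺′ (∈-map⁺ (a ∷_) (∈-allVecs every v)) (∈-map⁺ (λ x → map (x ∷_) (allVecs xs _)) (every a))

allBools : List Bool
allBools = true ∷ false ∷ []

∈-allBools : ∀ b → b ∈ allBools
∈-allBools true = here refl
∈-allBools false = there (here refl)

private
  toℚᵘ-frac : ∀ a b → toℚᵘ (frac a (suc b)) ℚᵘ.≃ mkℚᵘ (+ a) b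
  toℚᵘ-frac a b = ℚₚ.toℚᵘ-fromℚᵘ (mkℚᵘ (+ a) b)

  pos-*-* : ∀ x y z → + (x * y * z) ≡ + x ℤ.* + y ℤ.* + z
  pos-*-* x y z = trans (ℤₚ.pos-* (x * y) z) (cong (ℤ._* + z) (ℤₚ.pos-* x y))

frac-≤⇒*-≤ : ∀ a b c d → frac a (suc b) ℚ.≤ frac c (suc d) → a * suc d ≤ c * suc b
frac-≤⇒*-≤ a b c d le with ℚᵘₚ.≤-respʳ-≃ (toℚᵘ-frac c d) (ℚᵘₚ.≤-respˡ-≃ (toℚᵘ-frac a b) (ℚₚ.toℚᵘ-mono-≤ le))
... | ℚᵘ.*≤* cross = ℤₚ.drop‿+≤+ (subst₂ ℤ._≤_ (sym (ℤₚ.pos-* a (suc d))) (sym (ℤₚ.pos-* c (suc b))) cross)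

frac-ε<frac : ∀ a b c d e δ .(cop : Coprime e (suc δ)) →
  a * suc δ * suc d < c * suc δ * suc b + e * suc b * suc d →
  frac a (suc b) ℚ.- mkℚ (+ e) δ cop ℚ.< frac c (suc d)
frac-ε<frac a b c d e δ cop h = ℚₚ.toℚᵘ-cancel-<
  (ℚᵘₚ.<-respˡ-≃ (ℚᵘₚ.≃-sym lhs) (ℚᵘₚ.<-respʳ-≃ (ℚᵘₚ.≃-sym (toℚᵘ-frac c d)) (ℚᵘ.*<* cross)))
  where
  ε = mkℚ (+ e) δ cop
  lhs : toℚᵘ (frac a (suc b) ℚ.- ε) ℚᵘ.≃ mkℚᵘ (+ a) b ℚᵘ.- mkℚᵘ (+ e) δ
  lhs = ℚᵘₚ.≃-trans (ℚₚ.toℚᵘ-homo-+ (frac a (suc b)) (ℚ.- ε)) (ℚᵘₚ.+-cong (toℚᵘ-frac a b) (ℚₚ.toℚᵘ-homo‿- ε))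
  moved : + (a * suc δ * suc d) ℤ.- + (e * suc b * suc d) ℤ.< + (c * suc δ * suc b)
  moved = subst (+ (a * suc δ * suc d) ℤ.- + (e * suc b * suc d) ℤ.<_) (cancel (+ (c * suc δ * suc b)) (+ (e * suc b * suc d)))
            (ℤₚ.+-monoˡ-< (ℤ.- + (e * suc b * suc d))
              (subst (+ (a * suc δ * suc d) ℤ.<_) (ℤₚ.pos-+ (c * suc δ * suc b) (e * suc b * suc d)) (ℤ.+<+ h)))
    where
    cancel : ∀ y z → (y ℤ.+ z) ℤ.- z ≡ y
    cancel = ℤ-Solver.solve-∀
  cross : (+ a ℤ.* + suc δ ℤ.+ ℤ.- (+ e) ℤ.* + suc b) ℤ.* + suc d ℤ.< + c ℤ.* + (suc b * suc δ)
  cross = subst₂ ℤ._<_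
    (trans (cong₂ ℤ._-_ (pos-*-* a (suc δ) (suc d)) (pos-*-* e (suc b) (suc d))) (regroupˡ (+ a) (+ suc δ) (+ suc b) (+ suc d) (+ e)))
    (trans (pos-*-* c (suc δ) (suc b)) (trans (regroupʳ (+ c) (+ suc δ) (+ suc b)) (cong (+ c ℤ.*_) (sym (ℤₚ.pos-* (suc b) (suc δ))))))
    moved
    where
    regroupˡ : ∀ a D B d e → a ℤ.* D ℤ.* d ℤ.- e ℤ.* B ℤ.* d ≡ (a ℤ.* D ℤ.+ ℤ.- e ℤ.* B) ℤ.* d
    regroupˡ = ℤ-Solver.solve-∀
    regroupʳ : ∀ c D B → c ℤ.* D ℤ.* B ≡ c ℤ.* (B ℤ.* D)
    regroupʳ = ℤ-Solver.solve-∀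

frac<frac+ε : ∀ a b c d e δ .(cop : Coprime e (suc δ)) →
  c * suc b * suc δ < a * suc δ * suc d + e * suc b * suc d →
  frac c (suc d) ℚ.< frac a (suc b) ℚ.+ mkℚ (+ e) δ cop
frac<frac+ε a b c d e δ cop h = ℚₚ.toℚᵘ-cancel-<
  (ℚᵘₚ.<-respʳ-≃ (ℚᵘₚ.≃-sym rhs) (ℚᵘₚ.<-respˡ-≃ (ℚᵘₚ.≃-sym (toℚᵘ-frac c d)) (ℚᵘ.*<* cross)))
  where
  rhs : toℚᵘ (frac a (suc b) ℚ.+ mkℚ (+ e) δ cop) ℚᵘ.≃ mkℚᵘ (+ a) b ℚᵘ.+ mkℚᵘ (+ e) δ
  rhs = ℚᵘₚ.≃-trans (ℚₚ.toℚᵘ-homo-+ (frac a (suc b)) _) (ℚᵘₚ.+-cong (toℚᵘ-frac a b) ℚᵘₚ.≃-refl)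
  cross : + c ℤ.* + (suc b * suc δ) ℤ.< (+ a ℤ.* + suc δ ℤ.+ + e ℤ.* + suc b) ℤ.* + suc d
  cross = subst₂ ℤ._<_
    (trans (pos-*-* c (suc b) (suc δ)) (trans (regroupˡ (+ c) (+ suc b) (+ suc δ)) (cong (+ c ℤ.*_) (sym (ℤₚ.pos-* (suc b) (suc δ))))))
    (trans (ℤₚ.pos-+ (a * suc δ * suc d) (e * suc b * suc d))
      (trans (cong₂ ℤ._+_ (pos-*-* a (suc δ) (suc d)) (pos-*-* e (suc b) (suc d))) (regroupʳ (+ a) (+ suc δ) (+ suc d) (+ e) (+ suc b))))
    (ℤ.+<+ h)
    where
    regroupˡ : ∀ c B D → c ℤ.* B ℤ.* D ≡ c ℤ.* (B ℤ.* D)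
    regroupˡ = ℤ-Solver.solve-∀
    regroupʳ : ∀ a D d e B → a ℤ.* D ℤ.* d ℤ.+ e ℤ.* B ℤ.* d ≡ (a ℤ.* D ℤ.+ e ℤ.* B) ℤ.* d
    regroupʳ = ℤ-Solver.solve-∀

Eventually : (ℕ → Set) → Set
Eventually P = ∃ λ R → ∀ r → R ≤ r → P r

eventually-shift : ∀ κ {P : ℕ → Set} → Eventually (λ m → P (m + κ)) → Eventually P
eventually-shift κ {P} (R , h) = R + κ , λ r R+κ≤r →
  subst P (ℕₚ.m∸n+n≡m (ℕₚ.≤-trans (ℕₚ.m≤n+m κ R) R+κ≤r))
    (h (r ∸ κ) (subst (_≤ r ∸ κ) (ℕₚ.m+n∸n≡m R κ) (ℕₚ.∸-monoˡ-≤ κ R+κ≤r)))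

eventually-× : ∀ {P Q : ℕ → Set} → Eventually P → Eventually Q → Eventually (λ r → P r × Q r)
eventually-× (R₁ , p) (R₂ , q) = R₁ + R₂ , λ r R≤r →
  p r (ℕₚ.≤-trans (ℕₚ.m≤m+n R₁ R₂) R≤r) , q r (ℕₚ.≤-trans (ℕₚ.m≤n+m R₂ R₁) R≤r)

module _ (S b E : ℕ) (c B : ℕ → ℕ) (B-large : ∀ m → m ≤ B m) where

  private
    small-error : ∀ e δ B' → E * suc δ < suc B' → E * suc δ < suc e * suc b * suc B'
    small-error e δ B' h = ℕₚ.<-≤-trans h (ℕₚ.m≤n*m (suc B') (suc e * suc b))

  approx-below : (∀ m → S * B m ≤ suc b * c m + E) →
    ∀ ε → 0ℚ ℚ.< ε → Eventually (λ m → frac S (suc b) ℚ.- ε ℚ.< frac (c m) (B m))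
  approx-below bound (mkℚ (+ suc e) δ cop) _ = suc (E * suc δ) , λ m R≤m → below m (ℕₚ.≤-trans R≤m (B-large m))
    where
    below : ∀ m → suc (E * suc δ) ≤ B m → frac S (suc b) ℚ.- mkℚ (+ suc e) δ cop ℚ.< frac (c m) (B m)
    below m R≤B with B m | bound m
    ... | suc B' | h = frac-ε<frac S b (c m) B' (suc e) δ cop (begin-strict
        S * suc δ * suc B'                      ≡⟨ rearrange S (suc δ) (suc B') ⟩
        S * suc B' * suc δ                      ≤⟨ ℕₚ.*-monoˡ-≤ (suc δ) h ⟩
        (suc b * c m + E) * suc δ               ≡⟨ expand (suc b) (c m) E (suc δ) ⟩
        c m * suc δ * suc b + E * suc δ         <⟨ ℕₚ.+-monoʳ-< (c m * suc δ * suc b) (small-error e δ B' R≤B) ⟩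
        c m * suc δ * suc b + suc e * suc b * suc B' ∎)
      where
      open ℕₚ.≤-Reasoning
      rearrange : ∀ x y z → x * y * z ≡ x * z * y
      rearrange = solve-∀
      expand : ∀ b c E D → (b * c + E) * D ≡ c * D * b + E * D
      expand = solve-∀
  approx-below _ (mkℚ (+ zero) _ _) (ℚ.*<* (ℤ.+<+ ()))
  approx-below _ (mkℚ -[1+ _ ] _ _) (ℚ.*<* ())

  approx-above : (∀ m → suc b * c m ≤ S * B m + E) →
    ∀ ε → 0ℚ ℚ.< ε → Eventually (λ m → frac (c m) (B m) ℚ.< frac S (suc b) ℚ.+ ε)
  approx-above bound (mkℚ (+ suc e) δ cop) _ = suc (E * suc δ) , λ m R≤m → above m (ℕₚ.≤-trans R≤m (B-large m))
    where
    above : ∀ m → suc (E * suc δ) ≤ B m → frac (c m) (B m) ℚ.< frac S (suc b) ℚ.+ mkℚ (+ suc e) δ cop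
    above m R≤B with B m | bound m
    ... | suc B' | h = frac<frac+ε S b (c m) B' (suc e) δ cop (begin-strict
        c m * suc b * suc δ                     ≡⟨ rearrange (c m) (suc b) (suc δ) ⟩
        (suc b * c m) * suc δ                   ≤⟨ ℕₚ.*-monoˡ-≤ (suc δ) h ⟩
        (S * suc B' + E) * suc δ                ≡⟨ expand S (suc B') E (suc δ) ⟩
        S * suc δ * suc B' + E * suc δ          <⟨ ℕₚ.+-monoʳ-< (S * suc δ * suc B') (small-error e δ B' R≤B) ⟩
        S * suc δ * suc B' + suc e * suc b * suc B' ∎)
      where
      open ℕₚ.≤-Reasoning
      rearrange : ∀ c b D → c * b * D ≡ (b * c) * D
      rearrange = solve-∀
      expand : ∀ S B E D → (S * B + E) * D ≡ S * D * B + E * D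
      expand = solve-∀
  approx-above _ (mkℚ (+ zero) _ _) (ℚ.*<* (ℤ.+<+ ()))
  approx-above _ (mkℚ -[1+ _ ] _ _) (ℚ.*<* ())

-- Identifying codes are characterised by five-column windows

module _ {k : ℕ} where

  adj? : (u v : Vertex k) → Dec (Adj u v)
  adj? (x , y) (x' , y') =
          (x' ℤₚ.≟ x ℤ.+ 1ℤ ×-dec y' Finₚ.≟ y)
    ⊎-dec (x ℤₚ.≟ x' ℤ.+ 1ℤ ×-dec y Finₚ.≟ y')
    ⊎-dec (x ℤₚ.≟ x' ×-dec toℕ y' ℕ.≟ suc (toℕ y))
    ⊎-dec (x ℤₚ.≟ x' ×-dec toℕ y ℕ.≟ suc (toℕ y'))

  inN? : (v w : Vertex k) → Dec (InN v w)
  inN? v w = ≡-dec ℤₚ._≟_ Finₚ._≟_ v w ⊎-dec adj? v w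

  translate : ℤ → Vertex k → Vertex k
  translate d (x , y) = (d ℤ.+ x , y)

  Adj-translate : ∀ d {u v} → Adj u v → Adj (translate d u) (translate d v)
  Adj-translate d {x , _} (inj₁ (refl , e)) = inj₁ (sym (ℤₚ.+-assoc d x 1ℤ) , e)
  Adj-translate d {_ , _} {x' , _} (inj₂ (inj₁ (refl , e))) = inj₂ (inj₁ (sym (ℤₚ.+-assoc d x' 1ℤ) , e))
  Adj-translate d (inj₂ (inj₂ (inj₁ (refl , e)))) = inj₂ (inj₂ (inj₁ (refl , e)))
  Adj-translate d (inj₂ (inj₂ (inj₂ (refl , e)))) = inj₂ (inj₂ (inj₂ (refl , e)))

  InN-translate : ∀ d {u v} → InN u v → InN (translate d u) (translate d v)
  InN-translate d (inj₁ refl) = inj₁ refl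
  InN-translate d (inj₂ a) = inj₂ (Adj-translate d a)

  InN-untranslate : ∀ d {u v} → InN (translate d u) (translate d v) → InN u v
  InN-untranslate d {u} {v} n = subst₂ InN (back u) (back v) (InN-translate (ℤ.- d) n)
    where
    back : ∀ w → translate (ℤ.- d) (translate d w) ≡ w
    back (x , y) = cong (_, y) (cancel d x)
      where
      cancel : ∀ d x → ℤ.- d ℤ.+ (d ℤ.+ x) ≡ x
      cancel = ℤ-Solver.solve-∀

  InN-column : ∀ {x y x' y'} → InN {k} (x , y) (x' , y') → x' ≡ x ⊎ x' ≡ x ℤ.+ 1ℤ ⊎ x ≡ x' ℤ.+ 1ℤ
  InN-column (inj₁ refl) = inj₁ refl
  InN-column (inj₂ (inj₁ (e , _))) = inj₂ (inj₁ e)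
  InN-column (inj₂ (inj₂ (inj₁ (e , _)))) = inj₂ (inj₂ e)
  InN-column (inj₂ (inj₂ (inj₂ (inj₁ (e , _))))) = inj₁ (sym e)
  InN-column (inj₂ (inj₂ (inj₂ (inj₂ (e , _))))) = inj₁ (sym e)

  CodeNbr : Code k → Vertex k → Vertex k → Set
  CodeNbr C v w = InN v w × InCode C w

  Twins : Code k → Vertex k → Vertex k → Set
  Twins C u v = ∀ w → (CodeNbr C u w → CodeNbr C v w) × (CodeNbr C v w → CodeNbr C u w)

  -- A window is a family of columns of which only the first five matter: column 2 must be
  -- dominated, and each vertex of column 1 separated from the other vertices of columns 1 to 3.
  -- All their neighbours lie in columns 0 to 4.
  Columns : Set
  Columns = ℕ → Fin k → Bool

  WNbr : Columns → ℕ → Fin k → ℕ → Fin k → Set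
  WNbr H a y b w = InN {k} (+ a , y) (+ b , w) × H b w ≡ true

  WDominated : Columns → Set
  WDominated H = ∀ y → ∃ λ (i : Fin 5) → ∃ λ w → WNbr H 2 y (toℕ i) w

  WTwins : Columns → ℕ → Fin k → ℕ → Fin k → Set
  WTwins H a y b y' = ∀ (i : Fin 5) w →
    (WNbr H a y (toℕ i) w → WNbr H b y' (toℕ i) w) × (WNbr H b y' (toℕ i) w → WNbr H a y (toℕ i) w)

  WSeparated : Columns → Set
  WSeparated H = ∀ y (j : Fin 3) y' → ¬ (toℕ j ≡ 0 × y ≡ y') → ¬ WTwins H 1 y (suc (toℕ j)) y'

  WindowOK : Columns → Set
  WindowOK H = WDominated H × WSeparated H

  windowOK? : ∀ H → Dec (WindowOK H)
  windowOK? H = dominated? ×-dec separated?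
    where
    wNbr? : ∀ a y b w → Dec (WNbr H a y b w)
    wNbr? a y b w = inN? (+ a , y) (+ b , w) ×-dec H b w Boolₚ.≟ true
    dominated? : Dec (WDominated H)
    dominated? = Finₚ.all? λ y → Finₚ.any? λ i → Finₚ.any? λ w → wNbr? 2 y (toℕ i) w
    wTwins? : ∀ a y b y' → Dec (WTwins H a y b y')
    wTwins? a y b y' = Finₚ.all? λ i → Finₚ.all? λ w →
      (wNbr? a y (toℕ i) w →-dec wNbr? b y' (toℕ i) w) ×-dec (wNbr? b y' (toℕ i) w →-dec wNbr? a y (toℕ i) w)
    separated? : Dec (WSeparated H)
    separated? = Finₚ.all? λ y → Finₚ.all? λ j → Finₚ.all? λ y' →
      ¬? (toℕ j ℕ.≟ 0 ×-dec y Finₚ.≟ y') →-dec ¬? (wTwins? 1 y (suc (toℕ j)) y')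

  WindowOK-cong : ∀ {H H'} → (∀ a → a < 5 → ∀ w → H a w ≡ H' a w) → WindowOK H → WindowOK H'
  WindowOK-cong {H} {H'} H≗H' (dom , sep) = dom' , sep'
    where
    to : ∀ {a y} (i : Fin 5) {w} → WNbr H a y (toℕ i) w → WNbr H' a y (toℕ i) w
    to i (n , c) = n , trans (sym (H≗H' _ (Finₚ.toℕ<n i) _)) c
    from : ∀ {a y} (i : Fin 5) {w} → WNbr H' a y (toℕ i) w → WNbr H a y (toℕ i) w
    from i (n , c) = n , trans (H≗H' _ (Finₚ.toℕ<n i) _) c
    dom' : WDominated H'
    dom' y with dom y
    ... | i , w , m = i , w , to i m
    sep' : WSeparated H'
    sep' y j y' ne tw = sep y j y' ne λ i w →
      (λ m → from i (proj₁ (tw i w) (to i m))) , (λ m → from i (proj₂ (tw i w) (to i m)))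

  columnsAt : Code k → ℤ → Columns
  columnsAt C X b y = C (X ℤ.+ + b) y

  nbr-column : ∀ X a {y x' y'} → InN {k} (X ℤ.+ + suc a , y) (x' , y') →
    ∃ λ b → b ≤ suc (suc a) × x' ≡ X ℤ.+ + b
  nbr-column X a n with InN-column n
  ... | inj₁ e = suc a , ℕₚ.n≤1+n _ , e
  ... | inj₂ (inj₁ e) = suc (suc a) , ℕₚ.≤-refl , trans e (sym (+-suc-+1 X (suc a)))
  ... | inj₂ (inj₂ e) = a , ℕₚ.m≤n⇒m≤1+n (ℕₚ.n≤1+n a) ,
                        ∙-cancelʳ 1ℤ _ _ (trans (sym e) (+-suc-+1 X a))

  CodeNbr⇒WNbr : ∀ C X {a y b w} → CodeNbr C (X ℤ.+ + a , y) (X ℤ.+ + b , w) → WNbr (columnsAt C X) a y b w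
  CodeNbr⇒WNbr C X (n , c) = InN-untranslate X n , c

  WNbr⇒CodeNbr : ∀ C X {a y b w} → WNbr (columnsAt C X) a y b w → CodeNbr C (X ℤ.+ + a , y) (X ℤ.+ + b , w)
  WNbr⇒CodeNbr C X (n , c) = InN-translate X n , c

  WNbr-inclusion⇒CodeNbr-inclusion : ∀ C X a y c y' → a ≤ 2 →
    (∀ (i : Fin 5) w → WNbr (columnsAt C X) (suc a) y (toℕ i) w → WNbr (columnsAt C X) c y' (toℕ i) w) →
    ∀ w → CodeNbr C (X ℤ.+ + suc a , y) w → CodeNbr C (X ℤ.+ + c , y') w
  WNbr-inclusion⇒CodeNbr-inclusion C X a y c y' a≤2 incl (x' , w) (n , cw) with nbr-column X a n
  ... | b , b≤ , refl with toFin b (s≤s (ℕₚ.≤-trans b≤ (s≤s (s≤s a≤2))))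
  ... | i , refl = WNbr⇒CodeNbr C X (incl i w (CodeNbr⇒WNbr C X (n , cw)))

  identifying⇒windowOK : ∀ C → IsIdentifyingCode k C → ∀ X → WindowOK (columnsAt C X)
  identifying⇒windowOK C (dom , sep) X = dominated , separated
    where
    dominated : WDominated (columnsAt C X)
    dominated y with dom (X ℤ.+ + 2 , y)
    ... | (x' , y') , n , cw with nbr-column X 1 n
    ... | b , b≤3 , refl with toFin b (s≤s (ℕₚ.m≤n⇒m≤1+n b≤3))
    ... | i , refl = i , y' , CodeNbr⇒WNbr C X (n , cw)
    separated : WSeparated (columnsAt C X)
    separated y j y' same tw = sep (X ℤ.+ + 1 , y) (X ℤ.+ + suc (toℕ j) , y') distinct λ w →
        WNbr-inclusion⇒CodeNbr-inclusion C X 0 y (suc (toℕ j)) y' z≤n (λ i w → proj₁ (tw i w)) w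
      , WNbr-inclusion⇒CodeNbr-inclusion C X (toℕ j) y' 1 y (ℕₚ.≤-pred (Finₚ.toℕ<n j)) (λ i w → proj₂ (tw i w)) w
      where
      distinct : (X ℤ.+ + 1 , y) ≢ (X ℤ.+ + suc (toℕ j) , y')
      distinct e = same ( sym (ℕₚ.suc-injective (ℤₚ.+-injective (∙-cancelˡ X _ _ (cong proj₁ e))))
                        , cong proj₂ e)

  ∣Δ∣≤1 : ∀ {x y x' y'} → InN {k} (x , y) (x' , y') → ∣ x' ℤ.- x ∣ ≤ 1
  ∣Δ∣≤1 {x} {x' = x'} n with InN-column n
  ... | inj₁ refl = subst (_≤ 1) (sym (cong ∣_∣ (ℤₚ.+-inverseʳ x))) z≤n
  ... | inj₂ (inj₁ refl) = ℕₚ.≤-reflexive (cong ∣_∣ (step x))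
    where
    step : ∀ x → x ℤ.+ 1ℤ ℤ.- x ≡ 1ℤ
    step = ℤ-Solver.solve-∀
  ... | inj₂ (inj₂ refl) = ℕₚ.≤-reflexive (cong ∣_∣ (step x'))
    where
    step : ∀ x' → x' ℤ.- (x' ℤ.+ 1ℤ) ≡ ℤ.- 1ℤ
    step = ℤ-Solver.solve-∀

  common-nbr⇒∣Δ∣≤2 : ∀ {xu yu xv yv x' y'} → InN {k} (xu , yu) (x' , y') → InN {k} (xv , yv) (x' , y') →
    ∣ xv ℤ.- xu ∣ ≤ 2
  common-nbr⇒∣Δ∣≤2 {xu} {_} {xv} {_} {x'} nu nv = begin
    ∣ xv ℤ.- xu ∣                         ≡⟨ cong ∣_∣ (regroup xu xv x') ⟩
    ∣ (x' ℤ.- xu) ℤ.- (x' ℤ.- xv) ∣       ≤⟨ ℤₚ.∣i-j∣≤∣i∣+∣j∣ (x' ℤ.- xu) (x' ℤ.- xv) ⟩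
    ∣ x' ℤ.- xu ∣ ℕ.+ ∣ x' ℤ.- xv ∣       ≤⟨ ℕₚ.+-mono-≤ (∣Δ∣≤1 nu) (∣Δ∣≤1 nv) ⟩
    2                                     ∎
    where
    open ℕₚ.≤-Reasoning
    regroup : ∀ xu xv x' → xv ℤ.- xu ≡ (x' ℤ.- xu) ℤ.- (x' ℤ.- xv)
    regroup = ℤ-Solver.solve-∀

  twins⇒WTwins : ∀ C X {a y b y'} → Twins C (X ℤ.+ + a , y) (X ℤ.+ + b , y') → WTwins (columnsAt C X) a y b y'
  twins⇒WTwins C X tw i w =
      (λ m → CodeNbr⇒WNbr C X (proj₁ (tw (X ℤ.+ + toℕ i , w)) (WNbr⇒CodeNbr C X m)))
    , (λ m → CodeNbr⇒WNbr C X (proj₂ (tw (X ℤ.+ + toℕ i , w)) (WNbr⇒CodeNbr C X m)))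

  windowOK⇒identifying : ∀ C → (∀ X → WindowOK (columnsAt C X)) → IsIdentifyingCode k C
  windowOK⇒identifying C ok = dominating , separating
    where
    sub-add : ∀ x d → x ℤ.- d ℤ.+ d ≡ x
    sub-add = ℤ-Solver.solve-∀

    dominating : ∀ v → ∃ λ w → CodeNbr C v w
    dominating (x , y) with proj₁ (ok (x ℤ.- + 2)) y
    ... | i , w , m = (X ℤ.+ + toℕ i , w) , subst (λ t → CodeNbr C (t , y) (X ℤ.+ + toℕ i , w)) (sub-add x (+ 2)) (WNbr⇒CodeNbr C X m)
      where X = x ℤ.- + 2

    separated-rightwards : ∀ xu yu m yv → m ≤ 2 → (xu , yu) ≢ (xu ℤ.+ + m , yv) →
      ¬ Twins C (xu , yu) (xu ℤ.+ + m , yv)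
    separated-rightwards xu yu m yv m≤2 ne tw with toFin {3} m (s≤s m≤2)
    ... | j , refl = proj₂ (ok X) yu j yv same (twins⇒WTwins C X tw')
      where
      X = xu ℤ.- + 1
      eu : xu ≡ X ℤ.+ + 1
      eu = sym (sub-add xu (+ 1))
      ev : xu ℤ.+ + toℕ j ≡ X ℤ.+ + suc (toℕ j)
      ev = trans (cong (ℤ._+ + toℕ j) eu) (ℤₚ.+-assoc X (+ 1) (+ toℕ j))
      tw' : Twins C (X ℤ.+ + 1 , yu) (X ℤ.+ + suc (toℕ j) , yv)
      tw' = subst₂ (λ a b → Twins C (a , yu) (b , yv)) eu ev tw
      same : ¬ (toℕ j ≡ 0 × yu ≡ yv)
      same (j≡0 , refl) = ne (cong (_, yu) (sym (trans (cong (λ t → xu ℤ.+ + t) j≡0) (ℤₚ.+-identityʳ xu))))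

    separating : ∀ u v → u ≢ v → ¬ Twins C u v
    separating (xu , yu) (xv , yv) ne tw with dominating (xu , yu)
    ... | (x' , y') , nu , cw with ∣Δ∣≤⇒offset xu xv (common-nbr⇒∣Δ∣≤2 nu (proj₁ (proj₁ (tw _) (nu , cw))))
    ... | m , m≤2 , inj₁ refl = separated-rightwards xu yu m yv m≤2 ne tw
    ... | m , m≤2 , inj₂ refl = separated-rightwards xv yv m yu m≤2 (λ e → ne (sym e)) (λ w → swap (tw w))

-- Column sequences and cyclic words

Column : ℕ → Set
Column k = Vec Bool k

blocks : ℕ → ℕ
blocks k = 2 ^ (4 * k)

module _ {k : ℕ} where

  columnsOf : (ℕ → Column k) → ℕ → Columns
  columnsOf g t a = lookup (g (t + a))

  WindowOK-columnsOf : ∀ {g g' t t'} → (∀ a → a < 5 → g (t + a) ≡ g' (t' + a)) →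
    WindowOK (columnsOf g t) → WindowOK (columnsOf g' t')
  WindowOK-columnsOf eq = WindowOK-cong λ a a<5 w → cong (λ c → lookup c w) (eq a a<5)

  ValidUpTo : (ℕ → Column k) → ℕ → Set
  ValidUpTo g n = ∀ t → t + 4 < n → WindowOK (columnsOf g t)

  private
    encodeBit : Bool → Fin 2
    encodeBit b = if b then Fin.suc Fin.zero else Fin.zero

    encodeBit-injective : ∀ b b' → encodeBit b ≡ encodeBit b' → b ≡ b'
    encodeBit-injective true true _ = refl
    encodeBit-injective false false _ = refl
    encodeBit-injective true false ()
    encodeBit-injective false true ()

    bits : (ℕ → Column k) → ℕ → Fin 4 × Fin k → Fin 2
    bits g t (a , y) = encodeBit (lookup (g (t + toℕ a)) y)

  blockCode : (ℕ → Column k) → ℕ → Fin (blocks k)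
  blockCode g t = funToFin (bits g t ∘ remQuot k)

  blockCode-injective : ∀ g t t' → blockCode g t ≡ blockCode g t' → ∀ a → a < 4 → g (t + a) ≡ g (t' + a)
  blockCode-injective g t t' eq a a<4 = begin
      g (t + a)                   ≡⟨ cong (λ b → g (t + b)) (sym a'≡a) ⟩
      g (t + toℕ a')              ≡⟨ sym (Vecₚ.tabulate∘lookup _) ⟩
      tabulate (lookup (g (t + toℕ a')))   ≡⟨ Vecₚ.tabulate-cong same-bit ⟩
      tabulate (lookup (g (t' + toℕ a')))  ≡⟨ Vecₚ.tabulate∘lookup _ ⟩
      g (t' + toℕ a')             ≡⟨ cong (λ b → g (t' + b)) a'≡a ⟩
      g (t' + a)                  ∎
    where
    open ≡-Reasoning
    a' = fromℕ< a<4
    a'≡a : toℕ a' ≡ a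
    a'≡a = Finₚ.toℕ-fromℕ< a<4
    decode : ∀ s y → finToFun (blockCode g s) (combine a' y) ≡ bits g s (a' , y)
    decode s y = trans (Finₚ.finToFun-funToFin (bits g s ∘ remQuot k) (combine a' y))
                       (cong (bits g s) (Finₚ.remQuot-combine a' y))
    same-bit : ∀ y → lookup (g (t + toℕ a')) y ≡ lookup (g (t' + toℕ a')) y
    same-bit y = encodeBit-injective _ _
      (trans (sym (decode t y)) (trans (cong (λ c → finToFun c (combine a' y)) eq) (decode t' y)))

  repeated-block : ∀ g → ∃₂ λ i q → i + suc q ≤ blocks k × (∀ a → a < 4 → g (i + a) ≡ g (i + suc q + a))
  repeated-block g with Finₚ.pigeonhole (ℕₚ.n<1+n (blocks k)) (blockCode g ∘ toℕ)
  ... | i , j , i<j , same = toℕ i , toℕ j ∸ suc (toℕ i) , bound , repeat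
    where
    i+p≡j : toℕ i + suc (toℕ j ∸ suc (toℕ i)) ≡ toℕ j
    i+p≡j = trans (ℕₚ.+-suc (toℕ i) _) (ℕₚ.m+[n∸m]≡n i<j)
    bound : toℕ i + suc (toℕ j ∸ suc (toℕ i)) ≤ blocks k
    bound = subst (_≤ blocks k) (sym i+p≡j) (ℕₚ.≤-pred (Finₚ.toℕ<n j))
    repeat : ∀ a → a < 4 → g (toℕ i + a) ≡ g (toℕ i + suc (toℕ j ∸ suc (toℕ i)) + a)
    repeat a a<4 = trans (blockCode-injective g _ _ same a a<4) (cong (λ s → g (s + a)) (sym i+p≡j))

module _ {k : ℕ} where

  cyclic : ∀ {q} → Vec (Column k) (suc q) → ℕ → Column k
  cyclic {q} w t = lookup w (t mod suc q)

  cyclic-mod : ∀ {q} (w : Vec (Column k) (suc q)) s t → s % suc q ≡ t % suc q → cyclic w s ≡ cyclic w t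
  cyclic-mod {q} w s t eq = cong (lookup w) (Finₚ.fromℕ<-cong _ _ eq (m%n<n s (suc q)) (m%n<n t (suc q)))

  ValidCycle : ∀ {q} → Vec (Column k) (suc q) → Set
  ValidCycle {q} w = ∀ t → t < suc q → WindowOK (columnsOf (cyclic w) t)

  cycleWeight : ∀ {q} → Vec (Column k) (suc q) → ℕ
  cycleWeight {q} w = sumUpTo (weight ∘ cyclic w) (suc q)

  module Excision (g : ℕ → Column k) (i q : ℕ) (repeat : ∀ a → a < 4 → g (i + a) ≡ g (i + suc q + a)) where

    p : ℕ
    p = suc q

    loop : Vec (Column k) p
    loop = tabulate (λ s → g (i + toℕ s))

    cyclic-loop : ∀ t → cyclic loop t ≡ g (i + t % p)
    cyclic-loop t = trans (Vecₚ.lookup∘tabulate (λ s → g (i + toℕ s)) (t mod p))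
                          (cong (λ s → g (i + s)) (Finₚ.toℕ-fromℕ< (m%n<n t p)))

    loop-repeats : ∀ r → r < p + 4 → g (i + r) ≡ g (i + r % p)
    loop-repeats = periodic-extension (λ r → g (i + r)) p 4
      λ r r<4 → trans (cong g (sym (ℕₚ.+-assoc i p r))) (sym (repeat r r<4))

    loopWeight : ℕ
    loopWeight = sumUpTo (λ t → weight (g (i + t))) p

    cycleWeight-loop : cycleWeight loop ≡ loopWeight
    cycleWeight-loop = sumUpTo-cong p λ t t<p →
      cong weight (trans (cyclic-loop t) (cong (λ s → g (i + s)) (m<n⇒m%n≡m t<p)))

    loop-valid : ∀ n → ValidUpTo g n → i + p + 3 < n → ValidCycle loop
    loop-valid n valid i+p+3<n t t<p = WindowOK-columnsOf {g = g} {cyclic loop} {i + t} {t} window-agrees (valid (i + t) in-range)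
      where
      window-agrees : ∀ a → a < 5 → g (i + t + a) ≡ cyclic loop (t + a)
      window-agrees a a<5 = begin
          g (i + t + a)         ≡⟨ cong g (ℕₚ.+-assoc i t a) ⟩
          g (i + (t + a))       ≡⟨ loop-repeats (t + a) (ℕₚ.+-mono-≤ t<p (ℕₚ.≤-pred a<5)) ⟩
          g (i + (t + a) % p)   ≡⟨ sym (cyclic-loop (t + a)) ⟩
          cyclic loop (t + a)   ∎
        where open ≡-Reasoning
      in-range : i + t + 4 < n
      in-range = ℕₚ.≤-<-trans (subst (i + t + 4 ≤_) (shuffle i q) (ℕₚ.+-monoˡ-≤ 4 (ℕₚ.+-monoʳ-≤ i (ℕₚ.≤-pred t<p)))) i+p+3<n
        where
        shuffle : ∀ i q → i + q + 4 ≡ i + suc q + 3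
        shuffle = solve-∀

    rest : ℕ → Column k
    rest t with t <? i
    ... | yes _ = g t
    ... | no _ = g (t + p)

    rest-below : ∀ t → t < i → rest t ≡ g t
    rest-below t t<i with t <? i
    ... | yes _ = refl
    ... | no t≮i = ⊥-elim (t≮i t<i)

    rest-above : ∀ t → i ≤ t → rest t ≡ g (t + p)
    rest-above t i≤t with t <? i
    ... | yes t<i = ⊥-elim (ℕₚ.<⇒≱ t<i i≤t)
    ... | no _ = refl

    rest-seam : ∀ t → t ≤ i + 3 → rest t ≡ g t
    rest-seam t t≤i+3 with t <? i
    ... | yes _ = refl
    ... | no t≮i = begin
        g (t + p)       ≡⟨ cong (λ s → g (s + p)) (sym i+m≡t) ⟩
        g (i + m + p)   ≡⟨ cong g (shuffle i m p) ⟩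
        g (i + p + m)   ≡⟨ sym (repeat m m<4) ⟩
        g (i + m)       ≡⟨ cong g i+m≡t ⟩
        g t             ∎
      where
      open ≡-Reasoning
      m = t ∸ i
      i+m≡t : i + m ≡ t
      i+m≡t = ℕₚ.m+[n∸m]≡n (ℕₚ.≮⇒≥ t≮i)
      m<4 : m < 4
      m<4 = s≤s (ℕₚ.+-cancelˡ-≤ i m 3 (subst (_≤ i + 3) (sym i+m≡t) t≤i+3))
      shuffle : ∀ i m p → i + m + p ≡ i + p + m
      shuffle = solve-∀

    rest-valid : ∀ n → ValidUpTo g (n + p) → ValidUpTo rest n
    rest-valid n valid t t+4<n with t <? i
    ... | yes t<i = WindowOK-columnsOf {g = g} {rest} {t} {t} (λ a a<5 → sym (rest-seam (t + a) (seam a<5)))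
                                      (valid t (ℕₚ.<-≤-trans t+4<n (ℕₚ.m≤m+n n p)))
      where
      seam : ∀ {a} → a < 5 → t + a ≤ i + 3
      seam {a} a<5 = ℕₚ.≤-pred (subst (suc (t + a) ≤_) (shuffle i) (ℕₚ.+-mono-≤ t<i (ℕₚ.≤-pred a<5)))
        where
        shuffle : ∀ i → i + 4 ≡ suc (i + 3)
        shuffle = solve-∀
    ... | no t≮i = WindowOK-columnsOf {g = g} {rest} {t + p} {t}
          (λ a _ → trans (cong g (shuffle t p a)) (sym (rest-above (t + a) (ℕₚ.≤-trans (ℕₚ.≮⇒≥ t≮i) (ℕₚ.m≤m+n t a)))))
          (valid (t + p) (subst (_< n + p) (shuffle' t p) (ℕₚ.+-monoˡ-< p t+4<n)))
      where
      shuffle : ∀ t p a → t + p + a ≡ t + a + p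
      shuffle = solve-∀
      shuffle' : ∀ t p → t + 4 + p ≡ t + p + 4
      shuffle' = solve-∀

    weight-excision : ∀ r → sumUpTo (weight ∘ g) (i + (p + r)) ≡ sumUpTo (weight ∘ rest) (i + r) + loopWeight
    weight-excision r = begin
        sumUpTo (weight ∘ g) (i + (p + r))
          ≡⟨ sumUpTo-+ (weight ∘ g) i (p + r) ⟩
        before + sumUpTo (λ t → weight (g (i + t))) (p + r)
          ≡⟨ cong (λ s → before + s) (sumUpTo-+ (λ t → weight (g (i + t))) p r) ⟩
        before + (loopWeight + after)
          ≡⟨ shuffle before loopWeight after ⟩
        (before + after) + loopWeight
          ≡⟨ cong (_+ loopWeight) (cong₂ _+_ (sumUpTo-cong i λ t t<i → cong weight (sym (rest-below t t<i)))
                                            (sumUpTo-cong r λ t _ → cong weight (sym (rest-shifted t)))) ⟩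
        (sumUpTo (weight ∘ rest) i + sumUpTo (λ t → weight (rest (i + t))) r) + loopWeight
          ≡⟨ cong (_+ loopWeight) (sym (sumUpTo-+ (weight ∘ rest) i r)) ⟩
        sumUpTo (weight ∘ rest) (i + r) + loopWeight ∎
      where
      open ≡-Reasoning
      before = sumUpTo (weight ∘ g) i
      after = sumUpTo (λ t → weight (g (i + (p + t)))) r
      shuffle : ∀ a w b → a + (w + b) ≡ (a + b) + w
      shuffle = solve-∀
      rest-shifted : ∀ t → rest (i + t) ≡ g (i + (p + t))
      rest-shifted t = trans (rest-above (i + t) (ℕₚ.m≤m+n i t)) (cong g (reorder i t p))
        where
        reorder : ∀ i t p → i + t + p ≡ i + (p + t)
        reorder = solve-∀

module _ {k : ℕ} (S P : ℕ)
  (minimal : ∀ {q} (w : Vec (Column k) (suc q)) → suc q ≤ blocks k → ValidCycle w → S * suc q ≤ cycleWeight w * P)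
  where

  -- Repeatedly excise loops: each contributes at least S/P per column, and at most 4 + 2^(4k) columns remain.
  weight-lowerBound : ∀ n (g : ℕ → Column k) → ValidUpTo g n → S * (n ∸ (4 + blocks k)) ≤ P * sumUpTo (weight ∘ g) n
  weight-lowerBound = <-rec _ step
    where
    K = 4 + blocks k
    step : ∀ n → (∀ {m} → m < n → ∀ g → ValidUpTo g m → S * (m ∸ K) ≤ P * sumUpTo (weight ∘ g) m) →
           ∀ g → ValidUpTo g n → S * (n ∸ K) ≤ P * sumUpTo (weight ∘ g) n
    step n ih g valid with n ≤? K
    ... | yes n≤K = subst (_≤ P * sumUpTo (weight ∘ g) n)
                          (sym (trans (cong (S *_) (ℕₚ.m≤n⇒m∸n≡0 n≤K)) (ℕₚ.*-zeroʳ S))) z≤n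
    ... | no n≰K with repeated-block g
    ... | i , q , i+p≤M , repeat = begin
        S * (n ∸ K)                   ≡⟨ cong (λ z → S * (z ∸ K)) (sym n'+p≡n) ⟩
        S * ((n' + p) ∸ K)            ≤⟨ ℕₚ.*-monoʳ-≤ S ([m+n]∸o≤[m∸o]+n n' p K) ⟩
        S * ((n' ∸ K) + p)            ≡⟨ ℕₚ.*-distribˡ-+ S (n' ∸ K) p ⟩
        S * (n' ∸ K) + S * p          ≤⟨ ℕₚ.+-mono-≤ rest-bound loop-bound ⟩
        P * restWeight + loopWeight * P  ≡⟨ cong (λ s → P * restWeight + s) (ℕₚ.*-comm loopWeight P) ⟩
        P * restWeight + P * loopWeight  ≡⟨ sym (ℕₚ.*-distribˡ-+ P restWeight loopWeight) ⟩
        P * (restWeight + loopWeight)    ≡⟨ cong (P *_) (sym total) ⟩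
        P * sumUpTo (weight ∘ g) n    ∎
      where
      open ℕₚ.≤-Reasoning
      open Excision g i q repeat
      i+p+3<n : i + p + 3 < n
      i+p+3<n = ℕₚ.≤-<-trans (ℕₚ.+-monoˡ-≤ 3 i+p≤M)
                  (ℕₚ.<-trans (subst (blocks k + 3 <_) (ℕₚ.+-comm (blocks k) 4) (ℕₚ.+-monoʳ-< (blocks k) (ℕₚ.n<1+n 3)))
                              (ℕₚ.≰⇒> n≰K))
      r = n ∸ (i + p)
      n' = i + r
      i+[p+r]≡n : i + (p + r) ≡ n
      i+[p+r]≡n = trans (sym (ℕₚ.+-assoc i p r)) (ℕₚ.m+[n∸m]≡n (ℕₚ.≤-trans (ℕₚ.m≤m+n (i + p) 3) (ℕₚ.<⇒≤ i+p+3<n)))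
      n'+p≡n : n' + p ≡ n
      n'+p≡n = trans (shuffle i r p) i+[p+r]≡n
        where
        shuffle : ∀ i r p → i + r + p ≡ i + (p + r)
        shuffle = solve-∀
      restWeight = sumUpTo (weight ∘ rest) n'
      rest-bound : S * (n' ∸ K) ≤ P * restWeight
      rest-bound = ih (subst (n' <_) n'+p≡n (ℕₚ.m<m+n n' (s≤s z≤n))) rest
                      (rest-valid n' (subst (ValidUpTo g) (sym n'+p≡n) valid))
      loop-bound : S * p ≤ loopWeight * P
      loop-bound = subst (λ z → S * p ≤ z * P) cycleWeight-loop
                     (minimal loop (ℕₚ.≤-trans (ℕₚ.m≤n+m p i) i+p≤M) (loop-valid n valid i+p+3<n))
      total : sumUpTo (weight ∘ g) n ≡ restWeight + loopWeight
      total = trans (cong (sumUpTo (weight ∘ g)) (sym i+[p+r]≡n)) (weight-excision r)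

-- A valid cyclic word of least density

module _ {k : ℕ} where

  Cycle : Set
  Cycle = Σ ℕ λ q → Vec (Column k) (suc q)

  columnDensity : Cycle → ℚ
  columnDensity (q , w) = frac (cycleWeight w) (suc q)

  Admissible : Cycle → Set
  Admissible (q , w) = suc q ≤ blocks k × ValidCycle w

  admissible? : ∀ c → Dec (Admissible c)
  admissible? (q , w) = suc q ≤? blocks k ×-dec valid?
    where
    valid? : Dec (ValidCycle w)
    valid? with ℕₚ.allUpTo? (λ t → windowOK? (columnsOf (cyclic w) t)) (suc q)
    ... | yes all = yes λ t t<p → all t<p
    ... | no ¬all = no λ all → ¬all λ {t} t<p → all t t<p

  candidates : List Cycle
  candidates = concatMap (λ q → map (q ,_) (allVecs (allVecs allBools k) (suc q))) (upTo (blocks k))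

  ∈-candidates : ∀ {q} (w : Vec (Column k) (suc q)) → suc q ≤ blocks k → (q , w) ∈ candidates
  ∈-candidates {q} w q<M = ∈-concat⁺′ (∈-map⁺ (q ,_) (∈-allVecs (∈-allVecs ∈-allBools) w))
                                      (∈-map⁺ (λ q → map (q ,_) (allVecs (allVecs allBools k) (suc q))) (∈-upTo⁺ q<M))

  allTrue : Cycle
  allTrue = 0 , Vec.replicate k true ∷ []

  allTrue-admissible : Admissible allTrue
  allTrue-admissible = ℕₚ.m^n>0 2 (4 * k) , λ t _ → WindowOK-cong (all-true t) (dominated , separated)
    where
    all-true : ∀ t a → a < 5 → ∀ y → true ≡ columnsOf (cyclic (proj₂ allTrue)) t a y
    all-true t a _ y with (t + a) mod 1
    ... | Fin.zero = sym (Vecₚ.lookup-replicate y true)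
    dominated : WDominated (λ _ _ → true)
    dominated y = Fin.suc (Fin.suc Fin.zero) , y , inj₁ refl , refl
    separated : WSeparated (λ _ _ → true)
    separated y j y' not-same tw with proj₁ (tw Fin.zero y) (inj₂ (inj₂ (inj₁ (refl , refl))) , refl)
    ... | inj₂ (inj₂ (inj₁ (e , y'≡y))) , _ = not-same (ℕₚ.suc-injective (ℤₚ.+-injective e) , sym y'≡y)
    ... | inj₁ () , _
    ... | inj₂ (inj₁ (() , _)) , _
    ... | inj₂ (inj₂ (inj₂ (inj₁ (() , _)))) , _
    ... | inj₂ (inj₂ (inj₂ (inj₂ (() , _)))) , _

  -- Abstract, so that the type checker never evaluates the exhaustive search.
  abstract
    optimal : Cycle
    optimal = argmin columnDensity allTrue (filter admissible? candidates)

    optimal-admissible : Admissible optimal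
    optimal-admissible = argmin-all columnDensity allTrue-admissible (all-filter admissible? candidates)

    optimal-minimal : ∀ {q} (w : Vec (Column k) (suc q)) → suc q ≤ blocks k → ValidCycle w →
      cycleWeight (proj₂ optimal) * suc q ≤ cycleWeight w * suc (proj₁ optimal)
    optimal-minimal {q} w bound valid = frac-≤⇒*-≤ (cycleWeight (proj₂ optimal)) (proj₁ optimal) (cycleWeight w) q
      (All.lookup (f[argmin]≤f[xs] {f = columnDensity} allTrue (filter admissible? candidates))
                  (∈-filter⁺ admissible? (∈-candidates w bound) (bound , valid)))

module _ {k : ℕ} where

  columnWeight : Code k → ℤ → ℕ
  columnWeight C x = weight (Vec.tabulate (C x))

  ballColumn : Code k → ℕ → ℤ → ℕ
  ballColumn S r x = sum (map (λ y → if inBall r x y ∧ S x y then 1 else 0) (allFin k))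

  ballColumn-tabulate : ∀ S r x → ballColumn S r x ≡ weight (Vec.tabulate (λ y → inBall r x y ∧ S x y))
  ballColumn-tabulate S r x = trans (cong sum (Listₚ.map-tabulate (λ y → y) (λ y → bit (inBall r x y ∧ S x y))))
                                    (sum-tabulate-bit k _)

  countBall-columns : ∀ S r → countBall k S r ≡ sumUpTo (λ i → ballColumn S r (+ i ℤ.- + r)) (suc (r + r))
  countBall-columns S r = trans (cong sum (trans (sym (Listₚ.map-∘ (upTo (suc (r + r)))))
                                                 (Listₚ.map-upTo (λ i → ballColumn S r (+ i ℤ.- + r)) (suc (r + r)))))
                                (sum-applyUpTo (λ i → ballColumn S r (+ i ℤ.- + r)) (suc (r + r)))

  ballColumn-≤ : ∀ S r x → ballColumn S r x ≤ columnWeight S x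
  ballColumn-≤ S r x = subst₂ _≤_ (sym (ballColumn-tabulate S r x)) (sum-tabulate-bit k (S x))
    (subst (_≤ sum (List.tabulate (bit ∘ S x))) (sum-tabulate-bit k _) (sum-tabulate-mono k λ y → bit-∧ (inBall r x y) (S x y)))
    where
    sum-tabulate-mono : ∀ n {f g : Fin n → ℕ} → (∀ y → f y ≤ g y) → sum (List.tabulate f) ≤ sum (List.tabulate g)
    sum-tabulate-mono zero f≤g = z≤n
    sum-tabulate-mono (suc n) f≤g = ℕₚ.+-mono-≤ (f≤g Fin.zero) (sum-tabulate-mono n (f≤g ∘ Fin.suc))

  ballColumn-full : ∀ S r x → (∀ (y : Fin k) → ∣ x ∣ + toℕ y ≤ r) → ballColumn S r x ≡ columnWeight S x
  ballColumn-full S r x inside = trans (ballColumn-tabulate S r x)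
    (cong weight (Vecₚ.tabulate-cong λ y → cong (_∧ S x y) (Equivalence.to Boolₚ.T-≡ (ℕₚ.≤⇒≤ᵇ (inside y)))))

  countBall-≤ : ∀ S r → countBall k S r ≤ sumUpTo (λ i → columnWeight S (+ i ℤ.- + r)) (suc (r + r))
  countBall-≤ S r = subst (_≤ sumUpTo (λ i → columnWeight S (+ i ℤ.- + r)) (suc (r + r))) (sym (countBall-columns S r))
    (sumUpTo-mono-≤ (suc (r + r)) λ i _ → ballColumn-≤ S r (+ i ℤ.- + r))

  ballSize-≤ : ∀ r → ballSize k r ≤ suc (r + r) * k
  ballSize-≤ r = ℕₚ.≤-trans (countBall-≤ (λ _ _ → true) r)
    (ℕₚ.≤-reflexive (trans (sumUpTo-cong (suc (r + r)) λ _ _ → weight-allTrue k) (sumUpTo-const k (suc (r + r)))))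

module _ (κ : ℕ) where

  countBall-≥ : ∀ S m → sumUpTo (λ t → columnWeight S (+ t ℤ.- + m)) (suc (m + m)) ≤ countBall (suc κ) S (m + κ)
  countBall-≥ S m = begin
      sumUpTo (λ t → columnWeight S (+ t ℤ.- + m)) N
        ≡⟨ sumUpTo-cong N (λ t t<N → sym (trans (cong (ballColumn S r) (recentre t))
                                              (ballColumn-full S r (+ t ℤ.- + m) (inside t t<N)))) ⟩
      sumUpTo (λ t → F (κ + t)) N
        ≤⟨ sumUpTo-≤-+ (λ t → F (κ + t)) N κ ⟩
      sumUpTo (λ t → F (κ + t)) (N + κ)
        ≤⟨ ℕₚ.m≤n+m _ (sumUpTo F κ) ⟩
      sumUpTo F κ + sumUpTo (λ t → F (κ + t)) (N + κ)
        ≡⟨ sym (sumUpTo-+ F κ (N + κ)) ⟩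
      sumUpTo F (κ + (N + κ))
        ≡⟨ cong (sumUpTo F) (width κ m) ⟩
      sumUpTo F (suc (r + r))
        ≡⟨ sym (countBall-columns S r) ⟩
      countBall (suc κ) S r ∎
    where
    open ℕₚ.≤-Reasoning
    r = m + κ
    N = suc (m + m)
    F : ℕ → ℕ
    F i = ballColumn S r (+ i ℤ.- + r)
    width : ∀ κ m → κ + (suc (m + m) + κ) ≡ suc (m + κ + (m + κ))
    width = solve-∀
    recentre : ∀ t → + (κ + t) ℤ.- + r ≡ + t ℤ.- + m
    recentre t = trans (cong₂ (λ a b → a ℤ.- b) (ℤₚ.pos-+ κ t) (ℤₚ.pos-+ m κ)) (cancel (+ κ) (+ t) (+ m))
      where
      cancel : ∀ a b c → (a ℤ.+ b) ℤ.- (c ℤ.+ a) ≡ b ℤ.- c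
      cancel = ℤ-Solver.solve-∀
    inside : ∀ t → t < N → ∀ (y : Fin (suc κ)) → ∣ + t ℤ.- + m ∣ + toℕ y ≤ r
    inside t t<N y = ℕₚ.+-mono-≤ (subst (λ z → ∣ z ∣ ≤ m) (sym (ℤₚ.m-n≡m⊖n t m)) (∣i⊖m∣≤m t m (ℕₚ.≤-pred t<N)))
                                 (ℕₚ.≤-pred (Finₚ.toℕ<n y))

  ballSize-≥ : ∀ m → suc (m + m) * suc κ ≤ ballSize (suc κ) (m + κ)
  ballSize-≥ m = subst (_≤ ballSize (suc κ) (m + κ))
    (trans (sumUpTo-cong (suc (m + m)) λ _ _ → weight-allTrue (suc κ)) (sumUpTo-const (suc κ) (suc (m + m))))
    (countBall-≥ (λ _ _ → true) m)

-- The periodic code of a cyclic word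

module PeriodicCode {k q : ℕ} (w : Vec (Column k) (suc q)) where

  p : ℕ
  p = suc q

  -- A representative in ℕ of x modulo p: q (n + 1) ≡ -(n + 1) since q ≡ -1.
  residue : ℤ → ℕ
  residue (+ n) = n
  residue -[1+ n ] = q * suc n

  residue-+1 : ∀ x → residue (x ℤ.+ 1ℤ) % p ≡ (residue x + 1) % p
  residue-+1 (+ n) = refl
  residue-+1 -[1+ zero ] = sym (trans (cong (_% p) (q*1+1 q)) (n%n≡0 p))
    where
    q*1+1 : ∀ q → q * 1 + 1 ≡ suc q
    q*1+1 = solve-∀
  residue-+1 -[1+ suc n ] = sym (trans (cong (_% p) (unfold q n)) ([m+n]%n≡m%n (q * suc n) p))
    where
    unfold : ∀ q n → q * suc (suc n) + 1 ≡ q * suc n + suc q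
    unfold = solve-∀

  residue-+ : ∀ x i → residue (x ℤ.+ + i) % p ≡ (residue x + i) % p
  residue-+ x zero = trans (cong (λ z → residue z % p) (ℤₚ.+-identityʳ x)) (cong (_% p) (sym (ℕₚ.+-identityʳ (residue x))))
  residue-+ x (suc i) = begin
      residue (x ℤ.+ + suc i) % p         ≡⟨ cong (λ z → residue z % p) (+-suc-+1 x i) ⟩
      residue (x ℤ.+ + i ℤ.+ 1ℤ) % p      ≡⟨ residue-+1 (x ℤ.+ + i) ⟩
      (residue (x ℤ.+ + i) + 1) % p       ≡⟨ %-cong-+ p (residue (x ℤ.+ + i)) (residue x + i) 1 (residue-+ x i) ⟩
      (residue x + i + 1) % p             ≡⟨ cong (_% p) (trans (ℕₚ.+-assoc (residue x) i 1) (cong (λ z → residue x + z) (ℕₚ.+-comm i 1))) ⟩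
      (residue x + suc i) % p             ∎
    where open ≡-Reasoning

  code : Code k
  code x y = lookup (cyclic w (residue x)) y

  code-periodic : IsPeriodic k p code
  code-periodic x y = cong (λ c → lookup c y) (cyclic-mod w (residue (x ℤ.+ + p)) (residue x) (trans (residue-+ x p) ([m+n]%n≡m%n (residue x) p)))

  code-column : ∀ x i → cyclic w (residue (x ℤ.+ + i)) ≡ cyclic w (residue x % p + i)
  code-column x i = cyclic-mod w (residue (x ℤ.+ + i)) (residue x % p + i) (trans (residue-+ x i) (%-cong-+ p (residue x) (residue x % p) i (sym (m%n%n≡m%n (residue x) p))))

  code-identifying : ValidCycle w → IsIdentifyingCode k code
  code-identifying valid = windowOK⇒identifying code λ X →
    WindowOK-cong (λ a _ y → cong (λ c → lookup c y) (sym (code-column X a))) (valid (residue X % p) (m%n<n (residue X) p))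

  G : ℕ → ℕ
  G t = weight (cyclic w t)

  prefix-bound : ∀ n → p * sumUpTo G n ≤ cycleWeight w * (n + p)
  prefix-bound = <-rec _ step
    where
    S = cycleWeight w
    step : ∀ n → (∀ {m} → m < n → p * sumUpTo G m ≤ S * (m + p)) → p * sumUpTo G n ≤ S * (n + p)
    step n ih with n <? p
    ... | yes n<p = begin
        p * sumUpTo G n               ≤⟨ ℕₚ.*-monoʳ-≤ p (subst (sumUpTo G n ≤_) (cong (sumUpTo G) n+[p∸n]≡p) (sumUpTo-≤-+ G n (p ∸ n))) ⟩
        p * S                         ≡⟨ ℕₚ.*-comm p S ⟩
        S * p                         ≤⟨ ℕₚ.*-monoʳ-≤ S (ℕₚ.m≤n+m p n) ⟩
        S * (n + p)                   ∎
      where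
      open ℕₚ.≤-Reasoning
      n+[p∸n]≡p : n + (p ∸ n) ≡ p
      n+[p∸n]≡p = ℕₚ.m+[n∸m]≡n (ℕₚ.<⇒≤ n<p)
    ... | no n≮p = begin
        p * sumUpTo G n                           ≡⟨ cong (λ z → p * sumUpTo G z) (sym p+n'≡n) ⟩
        p * sumUpTo G (p + n')                    ≡⟨ cong (p *_) (sumUpTo-+ G p n') ⟩
        p * (S + sumUpTo (λ t → G (p + t)) n')    ≡⟨ cong (λ z → p * (S + z)) (sumUpTo-cong n' λ t _ → G-periodic t) ⟩
        p * (S + sumUpTo G n')                    ≡⟨ ℕₚ.*-distribˡ-+ p S _ ⟩
        p * S + p * sumUpTo G n'                  ≤⟨ ℕₚ.+-monoʳ-≤ (p * S) (ih n'<n) ⟩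
        p * S + S * (n' + p)                      ≡⟨ regroup p S n' ⟩
        S * ((p + n') + p)                        ≡⟨ cong (λ z → S * (z + p)) p+n'≡n ⟩
        S * (n + p)                               ∎
      where
      open ℕₚ.≤-Reasoning
      n' = n ∸ p
      p+n'≡n : p + n' ≡ n
      p+n'≡n = ℕₚ.m+[n∸m]≡n (ℕₚ.≮⇒≥ n≮p)
      n'<n : n' < n
      n'<n = subst (n' <_) p+n'≡n (ℕₚ.m<n+m n' (s≤s z≤n))
      G-periodic : ∀ t → G (p + t) ≡ G t
      G-periodic t = cong weight (cyclic-mod w (p + t) t (trans (cong (_% p) (ℕₚ.+-comm p t)) ([m+n]%n≡m%n t p)))
      regroup : ∀ p S n' → p * S + S * (n' + p) ≡ S * ((p + n') + p)
      regroup = solve-∀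

  columns-bound : ∀ x n → p * sumUpTo (λ i → columnWeight code (x ℤ.+ + i)) n ≤ cycleWeight w * (n + p + p)
  columns-bound x n = begin
      p * sumUpTo (λ i → columnWeight code (x ℤ.+ + i)) n
        ≡⟨ cong (p *_) (sumUpTo-cong n λ i _ → trans (cong weight (Vecₚ.tabulate∘lookup (cyclic w (residue (x ℤ.+ + i))))) (cong weight (code-column x i))) ⟩
      p * sumUpTo (λ i → G (c + i)) n
        ≤⟨ ℕₚ.*-monoʳ-≤ p (ℕₚ.m≤n+m _ (sumUpTo G c)) ⟩
      p * (sumUpTo G c + sumUpTo (λ i → G (c + i)) n)
        ≡⟨ cong (p *_) (sym (sumUpTo-+ G c n)) ⟩
      p * sumUpTo G (c + n)
        ≤⟨ prefix-bound (c + n) ⟩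
      cycleWeight w * (c + n + p)
        ≤⟨ ℕₚ.*-monoʳ-≤ (cycleWeight w) (subst₂ _≤_ (shuffle c n p) (shuffle' p n) (ℕₚ.+-monoˡ-≤ (n + p) (ℕₚ.<⇒≤ (m%n<n (residue x) p)))) ⟩
      cycleWeight w * (n + p + p) ∎
    where
    open ℕₚ.≤-Reasoning
    c = residue x % p
    shuffle : ∀ c n p → c + (n + p) ≡ c + n + p
    shuffle = solve-∀
    shuffle' : ∀ p n → p + (n + p) ≡ n + p + p
    shuffle' = solve-∀

module _ {k : ℕ} where

  columnsFrom : Code k → ℤ → ℕ → Column k
  columnsFrom C x t = Vec.tabulate (C (x ℤ.+ + t))

  columnsFrom-valid : ∀ C → IsIdentifyingCode k C → ∀ x n → ValidUpTo (columnsFrom C x) n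
  columnsFrom-valid C identifying x n t _ = WindowOK-cong same (identifying⇒windowOK C identifying (x ℤ.+ + t))
    where
    same : ∀ a → a < 5 → ∀ y → columnsAt C (x ℤ.+ + t) a y ≡ columnsOf (columnsFrom C x) t a y
    same a _ y = sym (trans (Vecₚ.lookup∘tabulate (C (x ℤ.+ + (t + a))) y)
                            (cong (λ z → C z y) (trans (cong (λ z → x ℤ.+ z) (ℤₚ.pos-+ t a)) (sym (ℤₚ.+-assoc x (+ t) (+ a))))))

module Optimum (κ : ℕ) where

  k : ℕ
  k = suc κ

  q : ℕ
  q = proj₁ (optimal {k})

  w : Vec (Column k) (suc q)
  w = proj₂ (optimal {k})

  -- suc b is P * k by definition: the number of vertices in one period.
  P S b : ℕ
  P = suc q
  S = cycleWeight w
  b = κ + q * suc κ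

  K : ℕ
  K = 4 + blocks k

  open PeriodicCode w public using (code; code-periodic; code-identifying; columns-bound)

  ballSize-large : ∀ m → m ≤ ballSize k (m + κ)
  ballSize-large m = ℕₚ.≤-trans (ℕₚ.n≤1+n m) (ℕₚ.≤-trans (ℕₚ.m≤m+n (suc m) (m + κ * suc (m + m)))
    (ℕₚ.≤-trans (ℕₚ.≤-reflexive (width m κ)) (ballSize-≥ κ m)))
    where
    width : ∀ m κ → suc m + (m + κ * suc (m + m)) ≡ suc (m + m) * suc κ
    width = solve-∀

  ball-lower : ∀ C → IsIdentifyingCode k C → ∀ m →
    S * ballSize k (m + κ) ≤ suc b * codeInBall k C (m + κ) + S * k * (K + κ + κ)
  ball-lower C identifying m = begin
      S * ballSize k r                    ≤⟨ ℕₚ.*-monoʳ-≤ S (ballSize-≤ r) ⟩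
      S * (suc (r + r) * k)               ≡⟨ cong (λ z → S * (z * k)) (width m κ) ⟩
      S * ((N + (κ + κ)) * k)             ≤⟨ ℕₚ.*-monoʳ-≤ S (ℕₚ.*-monoˡ-≤ k (ℕₚ.+-monoˡ-≤ (κ + κ) (ℕₚ.m≤n+m∸n N K))) ⟩
      S * ((K + (N ∸ K) + (κ + κ)) * k)   ≡⟨ regroup S K (N ∸ K) κ ⟩
      k * (S * (N ∸ K)) + E               ≤⟨ ℕₚ.+-monoˡ-≤ E (ℕₚ.*-monoʳ-≤ k columns-lower) ⟩
      k * (P * c) + E                     ≡⟨ cong (_+ E) (trans (ℕₚ.*-comm k (P * c)) (regroup′ P c k)) ⟩
      suc b * c + E                       ∎
    where
    open ℕₚ.≤-Reasoning
    r = m + κ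
    N = suc (m + m)
    c = codeInBall k C r
    E = S * k * (K + κ + κ)
    width : ∀ m κ → suc (m + κ + (m + κ)) ≡ suc (m + m) + (κ + κ)
    width = solve-∀
    regroup : ∀ S K Y κ → S * ((K + Y + (κ + κ)) * suc κ) ≡ suc κ * (S * Y) + S * suc κ * (K + κ + κ)
    regroup = solve-∀
    regroup′ : ∀ P c k → P * c * k ≡ P * k * c
    regroup′ = solve-∀
    columns-lower : S * (N ∸ K) ≤ P * c
    columns-lower = ℕₚ.≤-trans
      (weight-lowerBound S P optimal-minimal N (columnsFrom C (ℤ.- + m)) (columnsFrom-valid C identifying (ℤ.- + m) N))
      (ℕₚ.*-monoʳ-≤ P (subst (_≤ c)
        (sumUpTo-cong N λ t _ → cong (λ z → weight (Vec.tabulate (C z))) (ℤₚ.+-comm (+ t) (ℤ.- + m)))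
        (countBall-≥ κ C m)))

  ball-upper : ∀ m → suc b * codeInBall k code (m + κ) ≤ S * ballSize k (m + κ) + S * k * (κ + κ + P + P)
  ball-upper m = begin
      suc b * c                               ≡⟨ regroup P c k ⟩
      k * (P * c)                             ≤⟨ ℕₚ.*-monoʳ-≤ k columns-upper ⟩
      k * (S * (suc (r + r) + P + P))         ≡⟨ regroup′ S m κ P ⟩
      S * (suc (m + m) * k) + E               ≤⟨ ℕₚ.+-monoˡ-≤ E (ℕₚ.*-monoʳ-≤ S (ballSize-≥ κ m)) ⟩
      S * ballSize k r + E                    ∎
    where
    open ℕₚ.≤-Reasoning
    r = m + κ
    c = codeInBall k code r
    E = S * k * (κ + κ + P + P)
    regroup : ∀ P c k → P * k * c ≡ k * (P * c)
    regroup = solve-∀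
    regroup′ : ∀ S m κ P → suc κ * (S * (suc (m + κ + (m + κ)) + P + P)) ≡ S * (suc (m + m) * suc κ) + S * suc κ * (κ + κ + P + P)
    regroup′ = solve-∀
    columns-upper : P * c ≤ S * (suc (r + r) + P + P)
    columns-upper = ℕₚ.≤-trans (ℕₚ.*-monoʳ-≤ P (countBall-≤ code r))
      (subst (λ z → P * z ≤ S * (suc (r + r) + P + P))
        (sumUpTo-cong (suc (r + r)) λ i _ → cong (columnWeight code) (ℤₚ.+-comm (ℤ.- + r) (+ i)))
        (columns-bound (ℤ.- + r) (suc (r + r))))

theorem1 : ∀ (k : ℕ) → 1 ≤ k →
    ∃ λ (l : ℕ) → 1 ≤ l × l ≤ 2 ^ (4 * k) ×
    ∃ λ (C : Code k) → IsIdentifyingCode k C × IsPeriodic k l C ×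
    ∃ λ (d : ℚ) → HasDensity k C d × IsLowerBoundOfUpperDensities k d
theorem1 (suc κ) _ =
    P , s≤s z≤n , proj₁ optimal-admissible
  , code , code-identifying (proj₂ optimal-admissible) , code-periodic
  , frac S (suc b) , has-density , lower-bound
  where
  open Optimum κ
  below : ∀ C → IsIdentifyingCode k C → ∀ ε → 0ℚ ℚ.< ε →
    Eventually (λ r → frac S (suc b) ℚ.- ε ℚ.< ratio k C r)
  below C identifying ε ε>0 = eventually-shift κ {λ r → frac S (suc b) ℚ.- ε ℚ.< ratio k C r}
    (approx-below S b _ (λ m → codeInBall k C (m + κ)) (λ m → ballSize k (m + κ)) ballSize-large
                  (ball-lower C identifying) ε ε>0)
  has-density : HasDensity k code (frac S (suc b))
  has-density ε ε>0 = eventually-× (below code (code-identifying (proj₂ optimal-admissible)) ε ε>0)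
    (eventually-shift κ {λ r → ratio k code r ℚ.< frac S (suc b) ℚ.+ ε}
      (approx-above S b _ (λ m → codeInBall k code (m + κ)) (λ m → ballSize k (m + κ)) ballSize-large
                    ball-upper ε ε>0))
  lower-bound : IsLowerBoundOfUpperDensities k (frac S (suc b))
  lower-bound C identifying ε ε>0 R =
    R₀ + R , ℕₚ.m≤n+m R R₀ , proj₂ (below C identifying ε ε>0) (R₀ + R) (ℕₚ.m≤m+n R₀ R)
    where
    R₀ = proj₁ (below C identifying ε ε>0)
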